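{- Let $G$ be a finite simple connected graph and let $C$ be any cycle of length $l \geq 3$ in $G$. Let $W^+(G)$ be the graph obtained from $G$ by adding a new vertex $x$ and joining $x$ to every vertex of $C$. Then $$\chi_{dd}(G)-l \leq \chi_{dd}(W^+(G)) \leq \chi_{dd}(G) + 1.$$
   Context: All graphs are finite, simple, undirected and connected. For a vertex $v$, $N[v]$ denotes its closed neighborhood. A proper coloring of $G$ partitions $V(G)$ into independent sets $V_1,\dots,V_k$ (color classes). A vertex $u$ dominates a color class $V_i$ if $V_i \subseteq N[u]$ (so $u$ dominates its own class only when that class is $\{u\}$). A domination coloring of $G$ is a proper vertex coloring such that every vertex of $G$ dominates at least one color class, and every color class is dominated by at least one vertex. The domination chromatic number $\chi_{dd}(G)$ is the minimum number of color classes in a domination coloring of $G$. -}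

module Defs where

open import Data.Nat using (ℕ; zero; suc; _≤_; _+_)
open import Data.Fin using (Fin; toℕ) renaming (zero to fz; suc to fs)
open import Data.Product using (Σ; ∃; _×_; _,_)
open import Data.Sum using (_⊎_)
open import Data.Empty using (⊥)
open import Data.Unit using (⊤)
open import Relation.Nullary using (¬_)
open import Relation.Binary.PropositionalEquality using (_≡_; _≢_)
open import Function.Definitions using (Injective; Surjective)
open import Level using (0ℓ)

record Graph (n : ℕ) : Set₁ where
  field
    Adj    : Fin n → Fin n → Set
    sym    : ∀ {u v} → Adj u v → Adj v u
    irrefl : ∀ {u} → ¬ Adj u u
open Graph public

data Walk {n : ℕ} (G : Graph n) : Fin n → Fin n → Set where
  here : ∀ {u} → Walk G u u
  step : ∀ {u v w} → Adj G u v → Walk G v w → Walk G u w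

Connected : ∀ {n} → Graph n → Set
Connected G = ∀ u v → Walk G u v

record Cycle {n : ℕ} (G : Graph n) (l : ℕ) : Set where
  field
    len≥3  : 3 ≤ l
    vert   : Fin l → Fin n
    inj    : Injective _≡_ _≡_ vert
    edges  : ∀ (i j : Fin l) →
             (suc (toℕ i) ≡ toℕ j ⊎ (suc (toℕ i) ≡ l × toℕ j ≡ 0)) →
             Adj G (vert i) (vert j)
open Cycle public

OnCycle : ∀ {n l} {G : Graph n} → Cycle G l → Fin n → Set
OnCycle C u = ∃ λ i → vert C i ≡ u

-- W⁺(G): new vertex x = fz joined to every vertex of C; old vertex u becomes fs u.
W⁺Adj : ∀ {n l} (G : Graph n) → Cycle G l → Fin (suc n) → Fin (suc n) → Set
W⁺Adj G C fz     fz     = ⊥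
W⁺Adj G C fz     (fs v) = OnCycle C v
W⁺Adj G C (fs u) fz     = OnCycle C u
W⁺Adj G C (fs u) (fs v) = Adj G u v

W⁺sym : ∀ {n l} (G : Graph n) (C : Cycle G l) {u v} → W⁺Adj G C u v → W⁺Adj G C v u
W⁺sym G C {fz}   {fs v} p = p
W⁺sym G C {fs u} {fz}   p = p
W⁺sym G C {fs u} {fs v} p = sym G p

W⁺irrefl : ∀ {n l} (G : Graph n) (C : Cycle G l) {u} → ¬ W⁺Adj G C u u
W⁺irrefl G C {fz}   ()
W⁺irrefl G C {fs u} p = irrefl G p

W⁺ : ∀ {n l} (G : Graph n) → Cycle G l → Graph (suc n)
W⁺ G C = record { Adj = W⁺Adj G C ; sym = λ {u} {v} → W⁺sym G C {u} {v} ; irrefl = λ {u} → W⁺irrefl G C {u} }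

InN[_] : ∀ {n} {G : Graph n} → Fin n → Fin n → Set
InN[_] {G = G} u v = u ≡ v ⊎ Adj G u v

Dominates : ∀ {n k} (G : Graph n) (c : Fin n → Fin k) → Fin n → Fin k → Set
Dominates {n} G c u i = ∀ (v : Fin n) → c v ≡ i → InN[_] {G = G} u v

record DomColoring {n : ℕ} (G : Graph n) (k : ℕ) : Set where
  field
    col        : Fin n → Fin k
    proper     : ∀ {u v} → Adj G u v → col u ≢ col v
    onto       : ∀ (i : Fin k) → ∃ λ v → col v ≡ i
    vertDom    : ∀ (u : Fin n) → ∃ λ i → Dominates G col u i
    classDom   : ∀ (i : Fin k) → ∃ λ u → Dominates G col u i

IsχDD : ∀ {n} → Graph n → ℕ → Set
IsχDD G k = DomColoring G k × (∀ k' → DomColoring G k' → k ≤ k')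

-- Both bounds are proved by turning a domination colouring of one graph into
-- one of the other.  To avoid bookkeeping about empty colour classes we work
-- with *loose* domination colourings, which may leave colours unused and name
-- dominated classes by a representative vertex; every loose colouring with m
-- colours can be tightened to a genuine domination colouring with at most m
-- colours (by repeatedly deleting an unused colour), so χ_dd is a lower bound
-- for the palette size of any loose colouring.
--
-- Upper bound: extend a colouring of G by a fresh colour for x.
-- Lower bound: restrict a colouring of W⁺(G) to G and give each of the l cycle
-- vertices its own new colour.  This "isolation" refines the restricted
-- colouring, and refinement preserves domination of a representative's class;
-- the apex x is adjacent only to cycle vertices, so every off-cycle vertex and
-- class was already handled by an old vertex, while cycle vertices now form
-- singleton classes that dominate themselves.
module Submission where

open import Defs
open import Data.Nat using (ℕ; suc; zero; _≤_; _+_)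
open import Data.Nat.Properties using (≤-refl; ≤-trans; n≤1+n; +-comm)
open import Data.Fin using (Fin; _↑ˡ_; _↑ʳ_; splitAt; punchOut) renaming (zero to fz; suc to fs)
open import Data.Fin.Properties using (suc-injective; _≟_; any?; all?; ¬∀⟶∃¬; punchOut-injective; ↑ˡ-injective; ↑ʳ-injective; splitAt-↑ˡ; splitAt-↑ʳ)
open import Data.Product using (Σ; ∃; _×_; _,_; proj₁)
open import Data.Sum using (_⊎_; inj₁; inj₂)
open import Data.Empty using (⊥-elim)
open import Function.Definitions using (Injective)
open import Relation.Nullary using (¬_; yes; no)
open import Relation.Binary.PropositionalEquality using (_≡_; _≢_; refl; trans; cong; subst) renaming (sym to ≡-sym)

-- A domination colouring in which colours may be unused; every dominated
-- class is named by one of its members, which makes it nonempty.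
record LooseDomColoring {n : ℕ} (G : Graph n) (m : ℕ) : Set where
  field
    col      : Fin n → Fin m
    proper   : ∀ {u v} → Adj G u v → col u ≢ col v
    vertDom  : ∀ u → ∃ λ w → Dominates G col u (col w)
    classDom : ∀ w → ∃ λ u → Dominates G col u (col w)

-- Every domination colouring is loose: its classes are nonempty.
loosen : ∀ {n k} {G : Graph n} → DomColoring G k → LooseDomColoring G k
loosen {G = G} D = record
  { col = col ; proper = proper ; vertDom = vertDom′ ; classDom = λ w → classDom (col w) }
  where
  open DomColoring D
  vertDom′ : ∀ u → ∃ λ w → Dominates G col u (col w)
  vertDom′ u with vertDom u
  ... | i , u-dom with onto i
  ...   | w , refl = w , u-dom

-- Deleting a colour j that no vertex uses keeps a loose domination colouring:
-- the renaming punchOut j is injective on the colours in use.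
dropUnusedColour : ∀ {n m} {G : Graph n} (L : LooseDomColoring G (suc m)) (j : Fin (suc m)) →
                   (∀ v → j ≢ LooseDomColoring.col L v) → LooseDomColoring G m
dropUnusedColour {n} {m} {G} L j unused = record
  { col      = col′
  ; proper   = λ a e → proper a (reflect e)
  ; vertDom  = λ u → let (w , d) = vertDom u in w , transport d
  ; classDom = λ w → let (u , d) = classDom w in u , transport d
  }
  where
  open LooseDomColoring L
  col′ : Fin n → Fin m
  col′ v = punchOut (unused v)
  reflect : ∀ {u v} → col′ u ≡ col′ v → col u ≡ col v
  reflect = punchOut-injective (unused _) (unused _)
  transport : ∀ {u w} → Dominates G col u (col w) → Dominates G col′ u (col′ w)
  transport d v e = d v (reflect e)

tighten : ∀ {n} {G : Graph n} m → LooseDomColoring G m → Σ ℕ λ k → k ≤ m × DomColoring G k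
tighten {G = G} m L with all? (λ i → any? (λ v → LooseDomColoring.col L v ≟ i))
... | yes onto = m , ≤-refl , record
  { col = col ; proper = proper ; onto = onto
  ; vertDom = λ u → let (w , d) = vertDom u in col w , d
  ; classDom = classDom′ }
  where
  open LooseDomColoring L
  classDom′ : ∀ i → ∃ λ u → Dominates G col u i
  classDom′ i with onto i
  ... | w , refl = classDom w
tighten zero    L | no notOnto = ⊥-elim (notOnto (λ ()))
tighten (suc m) L | no notOnto
  with ¬∀⟶∃¬ (suc m) _ (λ i → any? (λ v → LooseDomColoring.col L v ≟ i)) notOnto
... | j , unusedJ =
  let (k , k≤m , D) = tighten m (dropUnusedColour L j (λ v e → unusedJ (v , ≡-sym e)))
  in  k , ≤-trans k≤m (n≤1+n m) , D

χdd-≤-loose : ∀ {n k m} {G : Graph n} → IsχDD G k → LooseDomColoring G m → k ≤ m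
χdd-≤-loose {m = m} (_ , minimal) L =
  let (k′ , k′≤m , D) = tighten m L in ≤-trans (minimal k′ D) k′≤m

refinement-dominates : ∀ {n m m′} (G : Graph n) (c : Fin n → Fin m) (c′ : Fin n → Fin m′) →
                       (∀ {v w} → c′ v ≡ c′ w → c v ≡ c w) →
                       ∀ {u w} → Dominates G c u (c w) → Dominates G c′ u (c′ w)
refinement-dominates G c c′ refines d v e = d v (refines e)

module Isolate {n l} (f : Fin l → Fin n) (f-inj : Injective _≡_ _≡_ f) {m} (c : Fin n → Fin m) where

  Image : Fin n → Set
  Image u = ∃ λ i → f i ≡ u

  colour : Fin n → Fin (m + l)
  colour u with any? (λ i → f i ≟ u)
  ... | yes (i , _) = m ↑ʳ i
  ... | no _        = c u ↑ˡ l

  colour-cases : ∀ u → (∃ λ i → f i ≡ u × colour u ≡ m ↑ʳ i) ⊎ (¬ Image u × colour u ≡ c u ↑ˡ l)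
  colour-cases u with any? (λ i → f i ≟ u)
  ... | yes (i , fi≡u) = inj₁ (i , fi≡u , refl)
  ... | no ¬image      = inj₂ (¬image , refl)

  colour-image : ∀ {i u} → f i ≡ u → colour u ≡ m ↑ʳ i
  colour-image {i} {u} fi≡u with colour-cases u
  ... | inj₁ (j , fj≡u , cu) = trans cu (cong (m ↑ʳ_) (f-inj (trans fj≡u (≡-sym fi≡u))))
  ... | inj₂ (¬image , _)    = ⊥-elim (¬image (i , fi≡u))

  old≢new : ∀ (a : Fin m) (b : Fin l) → a ↑ˡ l ≢ m ↑ʳ b
  old≢new a b e with trans (≡-sym (splitAt-↑ˡ m a l)) (trans (cong (splitAt m) e) (splitAt-↑ʳ m l b))
  ... | ()

  image-singleton : ∀ {v w} → Image w → colour v ≡ colour w → v ≡ w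
  image-singleton {v} {w} (i , fi≡w) e with colour-cases v
  ... | inj₁ (j , fj≡v , cv) =
        trans (≡-sym fj≡v) (trans (cong f (↑ʳ-injective m j i (trans (≡-sym cv) (trans e (colour-image fi≡w))))) fi≡w)
  ... | inj₂ (_ , cv) = ⊥-elim (old≢new _ _ (trans (≡-sym cv) (trans e (colour-image fi≡w))))

  refines : ∀ {v w} → colour v ≡ colour w → c v ≡ c w
  refines {v} {w} e with colour-cases w
  ... | inj₁ (i , fi≡w , _) with image-singleton (i , fi≡w) e
  ...   | refl = refl
  refines {v} {w} e | inj₂ (_ , cw) with colour-cases v
  ... | inj₁ (_ , _ , cv) = ⊥-elim (old≢new _ _ (trans (≡-sym cw) (trans (≡-sym e) cv)))
  ... | inj₂ (_ , cv)     = ↑ˡ-injective l _ _ (trans (≡-sym cv) (trans e cw))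

  isolate-proper : (G : Graph n) → (∀ {u v} → Adj G u v → c u ≢ c v) →
                   ∀ {u v} → Adj G u v → colour u ≢ colour v
  isolate-proper G proper {u} {v} a e with colour-cases v
  ... | inj₁ (i , fi≡v , _) with image-singleton (i , fi≡v) e
  ...   | refl = irrefl G a
  isolate-proper G proper a e | inj₂ _ = proper a (refines e)

  image-dominates-itself : (G : Graph n) → ∀ {u} → Image u → Dominates G colour u (colour u)
  image-dominates-itself G image v e with image-singleton image e
  ... | refl = inj₁ refl

module Apex {n l} (G : Graph n) (C : Cycle G l) {m} (c⁺ : Fin (suc n) → Fin m) where

  H : Graph (suc n)
  H = W⁺ G C

  -- Closed neighbourhoods of old vertices are the same in G and in W⁺(G).
  restrict-dominates : ∀ {u i} → Dominates H c⁺ (fs u) i → Dominates G (λ v → c⁺ (fs v)) u i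
  restrict-dominates d v e with d (fs v) e
  ... | inj₁ refl = inj₁ refl
  ... | inj₂ a    = inj₂ a

  apex-dominates-cycle-only : ∀ {w} → Dominates H c⁺ fz (c⁺ (fs w)) → OnCycle C w
  apex-dominates-cycle-only d with d _ refl
  ... | inj₁ ()
  ... | inj₂ onCycle = onCycle

  off-cycle-misses-apex : ∀ {u} → ¬ OnCycle C u → ¬ Dominates H c⁺ (fs u) (c⁺ fz)
  off-cycle-misses-apex offCycle d with d fz refl
  ... | inj₁ ()
  ... | inj₂ onCycle = offCycle onCycle

restrict-and-isolate : ∀ {n l k⁺} (G : Graph n) (C : Cycle G l) →
                       LooseDomColoring (W⁺ G C) k⁺ → LooseDomColoring G (k⁺ + l)
restrict-and-isolate {n} {k⁺ = k⁺} G C L⁺ = record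
  { col = colour
  ; proper = isolate-proper G proper⁺
  ; vertDom = vertDom′
  ; classDom = classDom′
  }
  where
  open LooseDomColoring L⁺ renaming (col to c⁺; proper to proper⁺; vertDom to vertDom⁺; classDom to classDom⁺)
  open Apex G C c⁺
  c : Fin n → Fin k⁺
  c v = c⁺ (fs v)
  open Isolate (vert C) (inj C) c

  refine : ∀ {u w} → Dominates G c u (c w) → Dominates G colour u (colour w)
  refine = refinement-dominates G c colour refines

  vertDom′ : ∀ u → ∃ λ w → Dominates G colour u (colour w)
  vertDom′ u with colour-cases u
  ... | inj₁ (i , fi≡u , _) = u , image-dominates-itself G (i , fi≡u)
  ... | inj₂ (offCycle , _) with vertDom⁺ (fs u)
  ...   | fz , d   = ⊥-elim (off-cycle-misses-apex offCycle d)
  ...   | fs w , d = w , refine (restrict-dominates d)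

  classDom′ : ∀ w → ∃ λ u → Dominates G colour u (colour w)
  classDom′ w with colour-cases w
  ... | inj₁ (i , fi≡w , _) = w , image-dominates-itself G (i , fi≡w)
  ... | inj₂ (offCycle , _) with classDom⁺ (fs w)
  ...   | fz , d   = ⊥-elim (offCycle (apex-dominates-cycle-only d))
  ...   | fs u , d = u , refine (restrict-dominates d)

-- Upper bound: colouring the apex with a fresh colour extends a loose colouring
-- of G to one of W⁺(G) with one more colour; the apex's class is {x}, which
-- the apex dominates, and old dominations lift unchanged.
extend-by-apex : ∀ {n l k} (G : Graph n) (C : Cycle G l) →
                 LooseDomColoring G k → LooseDomColoring (W⁺ G C) (suc k)
extend-by-apex {n} {k = k} G C L = record
  { col = c⁺ ; proper = λ {u} {v} → proper⁺ {u} {v} ; vertDom = vertDom⁺ ; classDom = classDom⁺ }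
  where
  open LooseDomColoring L
  H : Graph (suc n)
  H = W⁺ G C

  c⁺ : Fin (suc n) → Fin (suc k)
  c⁺ fz     = fz
  c⁺ (fs u) = fs (col u)

  proper⁺ : ∀ {u v} → Adj H u v → c⁺ u ≢ c⁺ v
  proper⁺ {fz}   {fs v} a ()
  proper⁺ {fs u} {fz}   a ()
  proper⁺ {fs u} {fs v} a e = proper a (suc-injective e)

  lift : ∀ {u w} → Dominates G col u (col w) → Dominates H c⁺ (fs u) (c⁺ (fs w))
  lift d fz ()
  lift d (fs v) e with d v (suc-injective e)
  ... | inj₁ refl = inj₁ refl
  ... | inj₂ a    = inj₂ a

  apex-dominates-itself : Dominates H c⁺ fz (c⁺ fz)
  apex-dominates-itself fz     e = inj₁ refl
  apex-dominates-itself (fs v) ()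

  vertDom⁺ : ∀ u → ∃ λ w → Dominates H c⁺ u (c⁺ w)
  vertDom⁺ fz     = fz , apex-dominates-itself
  vertDom⁺ (fs u) = let (w , d) = vertDom u in fs w , lift d

  classDom⁺ : ∀ w → ∃ λ u → Dominates H c⁺ u (c⁺ w)
  classDom⁺ fz     = fz , apex-dominates-itself
  classDom⁺ (fs w) = let (u , d) = classDom w in fs u , lift d

theorem6 : ∀ {n l : ℕ} (G : Graph n) → Connected G → (C : Cycle G l) →
           ∀ (k k⁺ : ℕ) → IsχDD G k → IsχDD (W⁺ G C) k⁺ →
           (k ≤ k⁺ + l) × (k⁺ ≤ k + 1)
theorem6 {l = l} G _ C k k⁺ χG χW⁺ = lower , upper
  where
  lower : k ≤ k⁺ + l
  lower = χdd-≤-loose χG (restrict-and-isolate G C (loosen (proj₁ χW⁺)))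
  upper : k⁺ ≤ k + 1
  upper = subst (k⁺ ≤_) (+-comm 1 k) (χdd-≤-loose χW⁺ (extend-by-apex G C (loosen (proj₁ χG))))
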